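{- Let $\overline{\mathsf{M}}^*$ be the complemented implicit knowledge-based HMS model obtained from an implicit knowledge-based HMS model by adding the derived explicit possibility correspondences $\Pi^*_i$. For every individual $i\in I$ and every event $E\in\Sigma$: (1) $A^*_i(E)=A_i(E)$; (2) $K_i(E)=L^*_i(E)\cap A^*_i(E)$.
   Context: Fix a non-empty set $\mathsf{At}$. An implicit knowledge-based HMS model $\langle I,\{S_\Phi\},(r^\Phi_\Psi),(\Lambda^*_i),(\alpha_i),v\rangle$: $I\ne\emptyset$; non-empty pairwise disjoint spaces $S_\Phi$ ($\Phi\subseteq\mathsf{At}$), ordered $S_{\Phi'}\succeq S_\Phi$ iff $\Phi\subseteq\Phi'$; $\Omega=\bigcup_\Phi S_\Phi$; $S_\omega$ = space containing $\omega$; surjections $r^\Phi_\Psi:S_\Phi\to S_\Psi$ ($\Psi\subseteq\Phi$), $r^\Phi_\Phi=\mathrm{id}$, $r^\Phi_\Upsilon=r^\Psi_\Upsilon\circ r^\Phi_\Psi$; $\omega_\Psi=r^\Phi_\Psi(\omega)$; for $D\subseteq S_\Phi$, $D_\Psi=r^\Phi_\Psi(D)$ (also written $D_{S_\Psi}$) and $D^\uparrow=\bigcup_{\Phi\subseteq\Psi}(r^\Psi_\Phi)^{ -1}(D)$. Events $E=D^\uparrow$, base-space $S(E)=S_\Phi$ (vacuous events $\emptyset^{S_\Phi}$ distinguished by base-space); $\Sigma$ = set of events; $\neg E=(S(E)\setminus D)^\uparrow$; conjunction = intersection; $v$ assigns events to atoms. $\Lambda^*_i:\Omega\to2^\Omega\setminus\{\emptyset\}$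 satisfies Reflexivity ($\omega\in\Lambda^*_i(\omega)$), Stationarity ($\omega'\in\Lambda^*_i(\omega)\Rightarrow\Lambda^*_i(\omega')=\Lambda^*_i(\omega)$), Projections Preserve Implicit Knowledge ($\omega\in S_\Phi$, $\Psi\subseteq\Phi\Rightarrow\Lambda^*_i(\omega)_\Psi=\Lambda^*_i(\omega_\Psi)$). $\alpha_i:\Omega\to\{S_\Phi\}$ satisfies (O) $\omega\in S_\Phi\Rightarrow\alpha_i(\omega)\preceq S_\Phi$; (I) $\omega'\in\Lambda^*_i(\omega)\Rightarrow\alpha_i(\omega')=\alpha_i(\omega)$; (II) $\omega\in S_\Phi$, $S_\Psi\preceq\alpha_i(\omega)\Rightarrow\alpha_i(\omega_\Psi)=S_\Psi$; (III) $\omega\in S_\Phi$, $\alpha_i(\omega)\preceq S_\Psi\preceq S_\Phi\Rightarrow\alpha_i(\omega_\Psi)=\alpha_i(\omega)$; (IV) $\omega\in S_\Phi$, $\Psi\subseteq\Phi\Rightarrow\alpha_i(\omega)\succeq\alpha_i(\omega_\Psi)$. Derived explicit possibility correspondence: $\Pi^*_i(\omega_\Phi):=\Lambda^*_i(\omega)_{\alpha_i(\omega_\Phi)}$ for all $\omega\in\Omega$ and $\Phi\subseteq\mathsf{At}$ (with $\omega_\Phi$ defined); $S_{\Pi^*_i(\omega)}$ denotes the space containing $\Pi^*_i(\omega)$. Operators: $A^*_i(E)=\{\omega:\alpha_i(\omega)\succeq S(E)\}$ if non-empty, else $\emptyset^{S(E)}$; $L^*_i(E)=\{\omega:\Lambda^*_i(\omega)\subseteq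 E\}$ if non-empty, else $\emptyset^{S(E)}$; $K_i(E)=\{\omega:\Pi^*_i(\omega)\subseteq E\}$ if non-empty, else $\emptyset^{S(E)}$; $A_i(E)=\{\omega:S_{\Pi^*_i(\omega)}\succeq S(E)\}$ if non-empty, else $\emptyset^{S(E)}$. -}

module Defs where

open import Data.Bool using (Bool; true; false; _∨_)
open import Data.Product using (Σ; ∃; _×_; _,_; proj₁; proj₂)
open import Relation.Binary.PropositionalEquality using (_≡_)
open import Function.Bundles using (_⇔_)

Sub : Set → Set
Sub At = At → Bool

-- Inclusion Φ ⊆ Ψ of atom sets (this also gives the space order:
-- S_Ψ ⪰ S_Φ  iff  Φ ⊆ Ψ).
_⊆_ : {At : Set} → Sub At → Sub At → Set
Φ ⊆ Ψ = ∀ a → Φ a ≡ true → Ψ a ≡ true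

⊆-refl : {At : Set} {Φ : Sub At} → Φ ⊆ Φ
⊆-refl a p = p

⊆-trans : {At : Set} {Φ Ψ Υ : Sub At} → Φ ⊆ Ψ → Ψ ⊆ Υ → Φ ⊆ Υ
⊆-trans p q a x = q a (p a x)

_∪_ : {At : Set} → Sub At → Sub At → Sub At
(Φ ∪ Ψ) a = Φ a ∨ Ψ a

-- Events E = D↑ with D ⊆ S_base: given by base-space index and D.
record Event {At : Set} (S : Sub At → Set) : Set₁ where
  field
    base : Sub At
    D    : S base → Set

-- Implicit knowledge-based HMS model.  Ω = Σ Φ, S Φ (the disjoint union
-- of the spaces S_Φ); a state ω = (Φ , x) lies in the space S_Φ.
record Model (At : Set) : Set₁ where
  field
    atom : At
    I    : Set
    ind  : I
    S    : Sub At → Set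
    pt   : ∀ Φ → S Φ
    r    : ∀ {Φ Ψ} → .(Ψ ⊆ Φ) → S Φ → S Ψ
    r-surj : ∀ {Φ Ψ} .(p : Ψ ⊆ Φ) (y : S Ψ) → ∃ λ x → r p x ≡ y
    r-id   : ∀ {Φ} (x : S Φ) → r {Φ} {Φ} ⊆-refl x ≡ x
    r-comp : ∀ {Φ Ψ Υ} .(p : Ψ ⊆ Φ) .(q : Υ ⊆ Ψ) (x : S Φ) →
             r (⊆-trans q p) x ≡ r q (r p x)
    v    : At → Event S
    Λ    : I → (Φ : Sub At) → S Φ → S Φ → Set
    Λ-nonempty : ∀ i Φ x → ∃ λ y → Λ i Φ x y
    reflexivity : ∀ i Φ x → Λ i Φ x x
    stationarity : ∀ i Φ x y → Λ i Φ x y → ∀ z → (Λ i Φ y z ⇔ Λ i Φ x z)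
    proj-preserve : ∀ i {Φ Ψ} (p : Ψ ⊆ Φ) (x : S Φ) (z : S Ψ) →
      ((∃ λ y → Λ i Φ x y × r p y ≡ z) ⇔ Λ i Ψ (r p x) z)
    -- awareness: α_i(Φ , x) is (the index of) a space
    α    : I → (Φ : Sub At) → S Φ → Sub At
    α-O   : ∀ i Φ x → α i Φ x ⊆ Φ
    α-I   : ∀ i Φ x y → Λ i Φ x y → α i Φ y ≡ α i Φ x
    α-II  : ∀ i Φ Ψ x (p : Ψ ⊆ Φ) → Ψ ⊆ α i Φ x → α i Ψ (r p x) ≡ Ψ
    α-III : ∀ i Φ Ψ x (p : Ψ ⊆ Φ) → α i Φ x ⊆ Ψ → α i Ψ (r p x) ≡ α i Φ x
    α-IV  : ∀ i Φ Ψ x (p : Ψ ⊆ Φ) → α i Ψ (r p x) ⊆ α i Φ x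

-- Operator outputs: a base-space and a membership predicate on Ω.
-- (A vacuous output ∅^{S(E)} is the one with empty membership.)
record OpEvent (At : Set) (S : Sub At → Set) : Set₁ where
  field
    base : Sub At
    mem  : (Φ : Sub At) → S Φ → Set

_≈E_ : {At : Set} {S : Sub At → Set} → OpEvent At S → OpEvent At S → Set
E ≈E F = (∀ a → OpEvent.base E a ≡ OpEvent.base F a)
       × (∀ Φ x → OpEvent.mem E Φ x ⇔ OpEvent.mem F Φ x)

_∩E_ : {At : Set} {S : Sub At → Set} → OpEvent At S → OpEvent At S → OpEvent At S
E ∩E F = record { base = OpEvent.base E ∪ OpEvent.base F
                ; mem  = λ Φ x → OpEvent.mem E Φ x × OpEvent.mem F Φ x }

module _ {At : Set} (M : Model At) where
  open Model M

  _∈E_ : (Σ (Sub At) S) → Event S → Set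
  (Φ , x) ∈E E = Σ (Event.base E ⊆ Φ) λ p → Event.D E (r p x)

  ΠSpace : I → (Φ : Sub At) → S Φ → Sub At
  ΠSpace i Φ x = α i Φ x

  Π* : ∀ i Φ (x : S Φ) → S (ΠSpace i Φ x) → Set
  Π* i Φ x z = ∃ λ y → Λ i Φ x y × r (α-O i Φ x) y ≡ z

  A* : I → Event S → OpEvent At S
  A* i E = record { base = Event.base E
                  ; mem  = λ Φ x → Event.base E ⊆ α i Φ x }

  L* : I → Event S → OpEvent At S
  L* i E = record { base = Event.base E
                  ; mem  = λ Φ x → ∀ y → Λ i Φ x y → (Φ , y) ∈E E }

  K : I → Event S → OpEvent At S
  K i E = record { base = Event.base E
                 ; mem  = λ Φ x → ∀ z → Π* i Φ x z → (ΠSpace i Φ x , z) ∈E E }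

  A : I → Event S → OpEvent At S
  A i E = record { base = Event.base E
                 ; mem  = λ Φ x → Event.base E ⊆ ΠSpace i Φ x }

-- Π*_i(ω) is Λ*_i(ω) projected to α_i(ω), and events are upward closed, so
-- for E based below α_i(ω) a state of Λ*_i(ω) lies in E exactly when its
-- projection does.  Reflexivity puts the projection of ω itself into Π*_i(ω),
-- so K_i(E) at ω forces S(E) ⪯ α_i(ω); the rest is bookkeeping.
module Submission where

open import Defs
open import Data.Bool.Properties using (∨-idem)
open import Data.Product using (_×_; _,_; proj₁)
open import Relation.Binary.PropositionalEquality using (refl; sym; subst)
open import Function.Bundles using (_⇔_; mk⇔; Equivalence)

module _ {At : Set} (M : Model At) (E : Event (Model.S M)) where
  open Model M
  open Event E using (base; D)

  ∈E-projection⇔ : ∀ {Φ Ψ} (p : Ψ ⊆ Φ) (x : S Φ) → base ⊆ Ψ →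
                   _∈E_ M (Φ , x) E ⇔ _∈E_ M (Ψ , r p x) E
  ∈E-projection⇔ p x b⊆Ψ = mk⇔ to from
    where
    -- r ignores its (irrelevant) inclusion proof, so r-comp applies to d as is.
    to : _∈E_ M (_ , x) E → _∈E_ M (_ , r p x) E
    to (_ , d) = b⊆Ψ , subst D (r-comp p b⊆Ψ x) d

    from : _∈E_ M (_ , r p x) E → _∈E_ M (_ , x) E
    from (q , d) = ⊆-trans q p , subst D (sym (r-comp p q x)) d

  module _ (i : I) where

    K⇒L*∩A* : ∀ Φ x → OpEvent.mem (K M i E) Φ x →
              OpEvent.mem (L* M i E ∩E A* M i E) Φ x
    K⇒L*∩A* Φ x known = knownImplicitly , aware
      where
      aware : base ⊆ α i Φ x
      aware = proj₁ (known _ (x , reflexivity i Φ x , refl))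

      knownImplicitly : ∀ y → Λ i Φ x y → _∈E_ M (Φ , y) E
      knownImplicitly y l =
        Equivalence.from (∈E-projection⇔ (α-O i Φ x) y aware) (known _ (y , l , refl))

    L*∩A*⇒K : ∀ Φ x → OpEvent.mem (L* M i E ∩E A* M i E) Φ x →
              OpEvent.mem (K M i E) Φ x
    L*∩A*⇒K Φ x (knownImplicitly , aware) z (y , l , refl) =
      Equivalence.to (∈E-projection⇔ (α-O i Φ x) y aware) (knownImplicitly y l)

proposition5 : {At : Set} (M : Model At) (i : Model.I M) (E : Event (Model.S M)) →
    (A* M i E ≈E A M i E) × (K M i E ≈E (L* M i E ∩E A* M i E))
proposition5 M i E =
  ((λ _ → refl) , λ _ _ → mk⇔ (λ a → a) (λ a → a)) ,
  ((λ a → sym (∨-idem (Event.base E a))) ,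
   λ Φ x → mk⇔ (K⇒L*∩A* M E i Φ x) (L*∩A*⇒K M E i Φ x))
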